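{- There exists a saturated $8$-Sperner family $\mathcal{F}$ of subsets of $\{1,2,\ldots,12\}$ with $|\mathcal{F}|=108$.
   Context: A family $\mathcal{F}$ of subsets of $\{1,2,\ldots,n\}$ is called $k$-Sperner if it does not contain $k+1$ distinct sets $A_1,\ldots,A_{k+1}$ with $A_1\subset A_2\subset\cdots\subset A_{k+1}$. It is called saturated $k$-Sperner if it is $k$-Sperner and, for every subset $S\subseteq\{1,\ldots,n\}$ with $S\notin\mathcal{F}$, the family $\mathcal{F}\cup\{S\}$ is not $k$-Sperner. -}

module Defs where

open import Data.Nat using (ℕ; suc)
open import Data.Fin using (Fin; zero; suc)
open import Data.Fin.Subset using (Subset; _⊂_)
open import Data.Vec using (Vec; lookup)
open import Data.List using (List)
open import Data.List.Membership.Propositional using (_∈_; _∉_)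
open import Data.Product using (∃; _×_)
open import Data.Sum using (_⊎_)
open import Relation.Nullary using (¬_)
open import Relation.Binary.PropositionalEquality using (_≡_)
open import Level using (0ℓ)

-- A family of subsets of {1,…,n} (modelled as Fin n) is a finite list of
-- subsets; it is used as a set via membership (duplicates are ruled out
-- separately, via Unique, when the cardinality is measured by length).
Family : ℕ → Set
Family n = List (Subset n)

-- A chain of m+1 sets A₀ ⊂ A₁ ⊂ … ⊂ Aₘ (strict inclusions, hence the sets
-- are automatically distinct), all lying in the collection P.
IsChainIn : ∀ {n m} → (Subset n → Set) → Vec (Subset n) (suc m) → Set
IsChainIn {n} {m} P A =
  (∀ i → P (lookup A i)) ×
  (∀ (i : Fin m) → lookup A (Data.Fin.inject₁ i) ⊂ lookup A (suc i))

KSpernerP : ∀ {n} → ℕ → (Subset n → Set) → Set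
KSpernerP {n} k P = ¬ ∃ (λ (A : Vec (Subset n) (suc k)) → IsChainIn P A)

KSperner : ∀ {n} → ℕ → Family n → Set
KSperner k F = KSpernerP k (λ A → A ∈ F)

SaturatedKSperner : ∀ {n} → ℕ → Family n → Set
SaturatedKSperner {n} k F =
  KSperner k F ×
  (∀ (S : Subset n) → S ∉ F → ¬ KSpernerP k (λ A → A ≡ S ⊎ A ∈ F))

{-# OPTIONS --safe #-}
module Submission where

open import Defs
open import Data.List using (length)
open import Data.List.Relation.Unary.Unique.Propositional using (Unique)
open import Data.Product using (∃; _×_)
open import Relation.Binary.PropositionalEquality using (_≡_)

open import Data.Bool as Bool using (if_then_else_)
open import Data.Empty using (⊥)
open import Data.Fin using (zero; suc; toℕ; fromℕ; inject₁)
open import Data.Fin.Induction using (<-weakInduction)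
open import Data.Fin.Properties using (toℕ-inject₁; toℕ-fromℕ; any?)
open import Data.Fin.Subset using (Subset; _⊂_; _⊆_) renaming (⊥ to ∅; ⊤ to full)
open import Data.Fin.Subset.Properties
  using (_⊂?_; _⊆?_; anySubset?; s⊆s; ⊥⊆; ⊆⊤; ⊆-trans; ⊆-antisym)
  renaming (_∈?_ to _∈ˢ?_)
open import Data.List using (List; []; _∷_; map; concat)
open import Data.List.Membership.Propositional using (_∈_; _∉_; find)
open import Data.List.Membership.Propositional.Properties using (∈-++⁻)
open import Data.List.Relation.Unary.All as All using (All)
open import Data.List.Relation.Unary.Any as Any using (Any)
open import Data.Maybe as Maybe using (Maybe; just; nothing; fromMaybe)
import Data.Maybe.Relation.Unary.All as MaybeAll
open MaybeAll using (just; nothing)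
open import Data.Nat using (ℕ; zero; suc; _+_; _<_; _≤_; _<?_; _≡ᵇ_; _%_; _/_; z≤n; s≤s)
open import Data.Nat.Properties using (≤-trans; <⇒≱)
open import Data.Product using (_,_; proj₁)
open import Data.Sum using (_⊎_; inj₁; inj₂; [_,_]′)
open import Data.Unit using (⊤; tt)
open import Data.Vec as Vec using (Vec; []; _∷_; lookup; _++_; splitAt)
open import Data.Vec.Properties using (≡-dec)
import Data.Vec.Relation.Unary.All as VecAll
open VecAll using ([]; _∷_)
open import Data.Vec.Relation.Unary.All.Properties using (lookup⁺; map⁺)
open import Data.Vec.Relation.Unary.Linked as Linked using (Linked; []; [-]; _∷_; linked?)
open import Function using (_∘_; flip; id)
open import Level using (0ℓ)
open import Relation.Binary using (Rel; DecidableEquality) renaming (Decidable to Decidable₂)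
open import Relation.Binary.PropositionalEquality using (_≢_; refl; sym; subst)
open import Relation.Nullary using (¬_; Dec; yes; no; does; contradiction)
open import Relation.Nullary.Decidable
  using (from-yes; decidable-stable; map′; ¬?; _×-dec_; _→-dec_)
open import Relation.Unary using (Decidable)

-- The family is the union of eight levels, level i consisting of the members
-- whose longest chain in the family below them has i sets; a strict inclusion
-- between members always climbs at least one level, so there is no chain of nine
-- members.  Every member either lies inside {1,…,8} or contains {9,…,12}.
-- Saturation is witnessed by 91 chains of eight members, each with an open slot
-- between its last member inside {1,…,8} and its first member containing
-- {9,…,12}: every s ⊆ {1,…,8} fits into one of these slots together with
-- s ∪ {9,…,12}, hence so does every set S with S ∩ {1,…,8} = s, and if S is not a
-- member, filling the slot with S gives a chain of nine sets.

module _ {n} {P : Subset n → Set} (rank : Subset n → ℕ)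
         (rank-mono : ∀ {A B} → P A → P B → A ⊂ B → rank A < rank B) where

  chain-rank : ∀ {m} {A : Vec (Subset n) (suc m)} → IsChainIn P A →
               ∀ i → toℕ i ≤ rank (lookup A i)
  chain-rank {A = A} (mem , ch) = <-weakInduction (λ i → toℕ i ≤ rank (lookup A i)) z≤n step
    where
    step : ∀ i → toℕ (inject₁ i) ≤ rank (lookup A (inject₁ i)) →
           suc (toℕ i) ≤ rank (lookup A (suc i))
    step i ih = ≤-trans (s≤s (subst (_≤ rank (lookup A (inject₁ i))) (toℕ-inject₁ i) ih))
                        (rank-mono (mem (inject₁ i)) (mem (suc i)) (ch i))

  bounded-rank⇒KSperner : ∀ {k} → (∀ {A} → P A → rank A < k) → KSpernerP k P
  bounded-rank⇒KSperner {k} rank<k (A , chain) =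
    <⇒≱ (rank<k (proj₁ chain (fromℕ k)))
        (subst (_≤ rank (lookup A (fromℕ k))) (toℕ-fromℕ k) (chain-rank {A = A} chain (fromℕ k)))

module _ {n : ℕ} where

  _≟_ : DecidableEquality (Subset n)
  _≟_ = ≡-dec Bool._≟_

  open import Data.List.Membership.DecPropositional _≟_ using (_∈?_)

  levelOf : List (List (Subset n)) → Subset n → ℕ
  levelOf []       A = 0
  levelOf (L ∷ Ls) A = if does (A ∈? L) then 0 else suc (levelOf Ls A)

  levelOf-< : ∀ Ls {A} → A ∈ concat Ls → levelOf Ls A < length Ls
  levelOf-< (L ∷ Ls) {A} A∈ with A ∈? L
  ... | yes _   = s≤s z≤n
  ... | no A∉L = s≤s ([ flip contradiction A∉L , levelOf-< Ls ]′ (∈-++⁻ L A∈))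

  levelled⇒KSperner : ∀ Ls →
    (∀ {A B} → A ∈ concat Ls → B ∈ concat Ls → A ⊂ B → levelOf Ls A < levelOf Ls B) →
    KSperner (length Ls) (concat Ls)
  levelled⇒KSperner Ls mono = bounded-rank⇒KSperner (levelOf Ls) mono (levelOf-< Ls)

  ⊆∧≢⇒⊂ : {p q : Subset n} → p ⊆ q → p ≢ q → p ⊂ q
  ⊆∧≢⇒⊂ {p} {q} p⊆q p≢q with any? (λ x → x ∈ˢ? q ×-dec ¬? (x ∈ˢ? p))
  ... | yes (x , x∈q , x∉p) = p⊆q , x , x∈q , x∉p
  ... | no ∄ = contradiction (⊆-antisym p⊆q q⊆p) p≢q
    where
    q⊆p : q ⊆ p
    q⊆p {x} x∈q = decidable-stable (x ∈ˢ? p) (λ x∉p → ∄ (x , x∈q , x∉p))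

allSubsets? : ∀ {n} {P : Subset n → Set} → Decidable P → Dec (∀ S → P S)
allSubsets? P? = map′ (λ ¬∃¬P S → decidable-stable (P? S) (λ ¬PS → ¬∃¬P (S , ¬PS)))
                      (λ ∀P (S , ¬PS) → ¬PS (∀P S))
                      (¬? (anySubset? (¬? ∘ P?)))

++-monoʳ-⊆ : ∀ {m h} (s : Subset m) {T T′ : Subset h} → T ⊆ T′ → s ++ T ⊆ s ++ T′
++-monoʳ-⊆ []      T⊆T′ = T⊆T′
++-monoʳ-⊆ (_ ∷ s) T⊆T′ = s⊆s (++-monoʳ-⊆ s T⊆T′)

between-extensions : ∀ m {h} (S : Subset (m + h)) → ∃ λ s → s ++ ∅ ⊆ S × S ⊆ s ++ full
between-extensions m S with s , T , refl ← splitAt m S = s , ++-monoʳ-⊆ s ⊥⊆ , ++-monoʳ-⊆ s ⊆⊤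

linked-adjacent : ∀ {a ℓ} {X : Set a} {R : Rel X ℓ} {m} {xs : Vec X (suc m)} →
                  Linked R xs → ∀ i → R (lookup xs (inject₁ i)) (lookup xs (suc i))
linked-adjacent {xs = _ ∷ _ ∷ _} (r ∷ _)  zero    = r
linked-adjacent {xs = _ ∷ _ ∷ _} (_ ∷ rs) (suc i) = linked-adjacent rs i

-- A gapped chain is a vector of sets in which `nothing` marks the slot for a new set.
module _ {n : ℕ} where

  fill : ∀ {m} → Subset n → Vec (Maybe (Subset n)) m → Vec (Subset n) m
  fill S = Vec.map (fromMaybe S)

  MembersIncrease : Rel (Maybe (Subset n)) 0ℓ
  MembersIncrease (just A) (just B) = A ⊂ B
  MembersIncrease _        _        = ⊤

  SlotAdmits : Subset n → Subset n → Rel (Maybe (Subset n)) 0ℓ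
  SlotAdmits P Q (just _) (just _) = ⊤
  SlotAdmits P Q (just A) nothing  = A ⊆ P
  SlotAdmits P Q nothing  (just B) = Q ⊆ B
  SlotAdmits P Q nothing  nothing  = ⊥

  membersIncrease? : Decidable₂ MembersIncrease
  membersIncrease? (just A) (just B) = A ⊂? B
  membersIncrease? (just _) nothing  = yes tt
  membersIncrease? nothing  _        = yes tt

  slotAdmits? : ∀ P Q → Decidable₂ (SlotAdmits P Q)
  slotAdmits? P Q (just _) (just _) = yes tt
  slotAdmits? P Q (just A) nothing  = A ⊆? P
  slotAdmits? P Q nothing  (just B) = Q ⊆? B
  slotAdmits? P Q nothing  nothing  = no id

  SlotAdmits-shrink : ∀ {P P′ Q Q′ x y} → P ⊆ P′ → Q′ ⊆ Q →
                      SlotAdmits P Q x y → SlotAdmits P′ Q′ x y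
  SlotAdmits-shrink {x = just _}  {just _}  _    _    _   = tt
  SlotAdmits-shrink {x = just _}  {nothing} P⊆P′ _    A⊆P = ⊆-trans A⊆P P⊆P′
  SlotAdmits-shrink {x = nothing} {just _}  _    Q′⊆Q Q⊆B = ⊆-trans Q′⊆Q Q⊆B

module _ {n} (F : Family n) where

  IsGappedChainIn : ∀ {m} → Vec (Maybe (Subset n)) m → Set
  IsGappedChainIn t = VecAll.All (MaybeAll.All (_∈ F)) t × Linked MembersIncrease t

  module _ {S} (S∉F : S ∉ F) where

    member≢S : ∀ {A} → A ∈ F → A ≢ S
    member≢S A∈F refl = S∉F A∈F

    fill-⊂ : ∀ {x y} → MaybeAll.All (_∈ F) x → MaybeAll.All (_∈ F) y →
             MembersIncrease x y → SlotAdmits S S x y → fromMaybe S x ⊂ fromMaybe S y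
    fill-⊂ (just _)   (just _)   A⊂B _   = A⊂B
    fill-⊂ (just A∈F) nothing    _   A⊆S = ⊆∧≢⇒⊂ A⊆S (member≢S A∈F)
    fill-⊂ nothing    (just B∈F) _   S⊆B = ⊆∧≢⇒⊂ S⊆B (member≢S B∈F ∘ sym)

    fill-increasing : ∀ {m} {t : Vec (Maybe (Subset n)) m} →
                      VecAll.All (MaybeAll.All (_∈ F)) t → Linked MembersIncrease t →
                      Linked (SlotAdmits S S) t → Linked _⊂_ (fill S t)
    fill-increasing []             []            []            = []
    fill-increasing (_ ∷ [])       [-]           [-]           = [-]
    fill-increasing (x∈ ∷ y∈ ∷ t∈) (x⊂y ∷ incr) (x~y ∷ fits) =
      fill-⊂ x∈ y∈ x⊂y x~y ∷ fill-increasing (y∈ ∷ t∈) incr fits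

    fill-chain : ∀ {m} {t : Vec (Maybe (Subset n)) (suc m)} →
                 IsGappedChainIn t → Linked (SlotAdmits S S) t →
                 IsChainIn (λ A → A ≡ S ⊎ A ∈ F) (fill S t)
    fill-chain {t = t} (t⊆F , incr) fits =
      lookup⁺ filled-∈ , linked-adjacent (fill-increasing t⊆F incr fits)
      where
      fromMaybe-∈ : ∀ {x} → MaybeAll.All (_∈ F) x → fromMaybe S x ≡ S ⊎ fromMaybe S x ∈ F
      fromMaybe-∈ nothing    = inj₁ refl
      fromMaybe-∈ (just A∈F) = inj₂ A∈F

      filled-∈ : VecAll.All (λ A → A ≡ S ⊎ A ∈ F) (fill S t)
      filled-∈ = map⁺ (VecAll.map fromMaybe-∈ t⊆F)

  gapped-chains⇒saturating : ∀ {k} (ts : List (Vec (Maybe (Subset n)) (suc k))) →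
    All IsGappedChainIn ts →
    (∀ S → Any (Linked (SlotAdmits S S)) ts) →
    ∀ S → S ∉ F → ¬ KSpernerP k (λ A → A ≡ S ⊎ A ∈ F)
  gapped-chains⇒saturating ts gapped slotted S S∉F sperner
    with t , t∈ts , fits ← find (slotted S) =
    sperner (fill S t , fill-chain S∉F (All.lookup gapped t∈ts) fits)

-- Bit i of the code (least significant first) says whether i belongs to the set.
fromCode : ∀ n → ℕ → Subset n
fromCode zero    c = []
fromCode (suc n) c = (c % 2 ≡ᵇ 1) ∷ fromCode n (c / 2)

levelCodes : List (List ℕ)
levelCodes =
    (0 ∷ [])
  ∷ (1 ∷ 2 ∷ 4 ∷ 16 ∷ 32 ∷ 64 ∷ 3976 ∷ [])
  ∷ (3 ∷ 5 ∷ 6 ∷ 10 ∷ 17 ∷ 18 ∷ 24 ∷ 33 ∷ 65 ∷ 72 ∷ 80 ∷ 132 ∷ 160 ∷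
     3884 ∷ 3892 ∷ 3938 ∷ 3940 ∷ 3977 ∷ 3984 ∷ 4034 ∷ [])
  ∷ (13 ∷ 19 ∷ 38 ∷ 56 ∷ 74 ∷ 84 ∷ 97 ∷ 134 ∷ 152 ∷ 161 ∷ 162 ∷ 176 ∷
     193 ∷ 200 ∷ 3870 ∷ 3883 ∷ 3893 ∷ 3911 ∷ 3929 ∷ 3948 ∷ 3954 ∷
     3979 ∷ 3989 ∷ 4012 ∷ 4050 ∷ 4068 ∷ [])
  ∷ (29 ∷ 45 ∷ 51 ∷ 90 ∷ 106 ∷ 116 ∷ 135 ∷ 166 ∷ 184 ∷ 198 ∷ 209 ∷
     225 ∷ 3902 ∷ 3919 ∷ 3927 ∷ 3943 ∷ 3961 ∷ 3995 ∷ 3998 ∷ 4011 ∷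
     4021 ∷ 4043 ∷ 4045 ∷ 4060 ∷ 4076 ∷ 4082 ∷ [])
  ∷ (91 ∷ 143 ∷ 174 ∷ 217 ∷ 230 ∷ 241 ∷ 3903 ∷ 3951 ∷ 3959 ∷ 3965 ∷
     3966 ∷ 4023 ∷ 4027 ∷ 4029 ∷ 4055 ∷ 4062 ∷ 4075 ∷ 4077 ∷ 4090 ∷
     4092 ∷ [])
  ∷ (207 ∷ 3967 ∷ 4031 ∷ 4087 ∷ 4091 ∷ 4093 ∷ 4094 ∷ [])
  ∷ (4095 ∷ [])
  ∷ []

levels : List (List (Subset 12))
levels = map (map (fromCode 12)) levelCodes

family : Family 12
family = concat levels

gappedChainCodes : List (Vec (Maybe ℕ) 9)
gappedChainCodes =
    (just 0 ∷ just 1 ∷ just 3 ∷ just 19 ∷ just 51 ∷ nothing ∷ just 3903 ∷ just 3967 ∷ just 4095 ∷ [])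
  ∷ (just 0 ∷ just 1 ∷ just 3 ∷ just 19 ∷ nothing ∷ just 3927 ∷ just 3959 ∷ just 3967 ∷ just 4095 ∷ [])
  ∷ (just 0 ∷ just 1 ∷ just 3 ∷ nothing ∷ just 3883 ∷ just 4011 ∷ just 4027 ∷ just 4031 ∷ just 4095 ∷ [])
  ∷ (just 0 ∷ just 1 ∷ just 5 ∷ just 13 ∷ just 29 ∷ nothing ∷ just 3965 ∷ just 3967 ∷ just 4095 ∷ [])
  ∷ (just 0 ∷ just 1 ∷ just 5 ∷ just 13 ∷ just 45 ∷ nothing ∷ just 3951 ∷ just 3967 ∷ just 4095 ∷ [])
  ∷ (just 0 ∷ just 1 ∷ just 5 ∷ just 13 ∷ nothing ∷ just 3919 ∷ just 3951 ∷ just 3967 ∷ just 4095 ∷ [])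
  ∷ (just 0 ∷ just 1 ∷ just 5 ∷ nothing ∷ just 3893 ∷ just 4021 ∷ just 4023 ∷ just 4031 ∷ just 4095 ∷ [])
  ∷ (just 0 ∷ just 1 ∷ just 17 ∷ nothing ∷ just 3929 ∷ just 3961 ∷ just 3965 ∷ just 3967 ∷ just 4095 ∷ [])
  ∷ (just 0 ∷ just 1 ∷ just 33 ∷ just 97 ∷ just 225 ∷ just 241 ∷ nothing ∷ just 4087 ∷ just 4095 ∷ [])
  ∷ (just 0 ∷ just 1 ∷ just 33 ∷ just 97 ∷ just 225 ∷ nothing ∷ just 4075 ∷ just 4091 ∷ just 4095 ∷ [])
  ∷ (just 0 ∷ just 1 ∷ just 33 ∷ just 97 ∷ nothing ∷ just 3943 ∷ just 3951 ∷ just 3967 ∷ just 4095 ∷ [])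
  ∷ (just 0 ∷ just 1 ∷ just 33 ∷ just 161 ∷ nothing ∷ just 4011 ∷ just 4027 ∷ just 4031 ∷ just 4095 ∷ [])
  ∷ (just 0 ∷ just 1 ∷ just 65 ∷ just 193 ∷ just 209 ∷ just 217 ∷ nothing ∷ just 4091 ∷ just 4095 ∷ [])
  ∷ (just 0 ∷ just 1 ∷ just 65 ∷ just 193 ∷ just 209 ∷ nothing ∷ just 4055 ∷ just 4087 ∷ just 4095 ∷ [])
  ∷ (just 0 ∷ just 1 ∷ just 65 ∷ just 193 ∷ nothing ∷ just 4043 ∷ just 4075 ∷ just 4091 ∷ just 4095 ∷ [])
  ∷ (just 0 ∷ just 1 ∷ just 65 ∷ nothing ∷ just 3911 ∷ just 3919 ∷ just 3951 ∷ just 3967 ∷ just 4095 ∷ [])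
  ∷ (just 0 ∷ just 1 ∷ nothing ∷ just 3977 ∷ just 3979 ∷ just 3995 ∷ just 4027 ∷ just 4031 ∷ just 4095 ∷ [])
  ∷ (just 0 ∷ just 2 ∷ just 6 ∷ just 38 ∷ just 166 ∷ just 174 ∷ nothing ∷ just 4031 ∷ just 4095 ∷ [])
  ∷ (just 0 ∷ just 2 ∷ just 6 ∷ just 38 ∷ just 166 ∷ just 230 ∷ nothing ∷ just 4094 ∷ just 4095 ∷ [])
  ∷ (just 0 ∷ just 2 ∷ just 6 ∷ just 38 ∷ just 166 ∷ nothing ∷ just 4023 ∷ just 4031 ∷ just 4095 ∷ [])
  ∷ (just 0 ∷ just 2 ∷ just 6 ∷ just 38 ∷ nothing ∷ just 3902 ∷ just 3903 ∷ just 3967 ∷ just 4095 ∷ [])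
  ∷ (just 0 ∷ just 2 ∷ just 6 ∷ just 134 ∷ just 135 ∷ just 143 ∷ just 207 ∷ nothing ∷ just 4095 ∷ [])
  ∷ (just 0 ∷ just 2 ∷ just 6 ∷ just 134 ∷ just 198 ∷ nothing ∷ just 4062 ∷ just 4094 ∷ just 4095 ∷ [])
  ∷ (just 0 ∷ just 2 ∷ just 6 ∷ just 134 ∷ nothing ∷ just 3998 ∷ just 4062 ∷ just 4094 ∷ just 4095 ∷ [])
  ∷ (just 0 ∷ just 2 ∷ just 6 ∷ nothing ∷ just 3870 ∷ just 3902 ∷ just 3903 ∷ just 3967 ∷ just 4095 ∷ [])
  ∷ (just 0 ∷ just 2 ∷ just 10 ∷ just 74 ∷ just 90 ∷ just 91 ∷ nothing ∷ just 3967 ∷ just 4095 ∷ [])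
  ∷ (just 0 ∷ just 2 ∷ just 10 ∷ just 74 ∷ just 90 ∷ nothing ∷ just 3966 ∷ just 3967 ∷ just 4095 ∷ [])
  ∷ (just 0 ∷ just 2 ∷ just 18 ∷ nothing ∷ just 3954 ∷ just 4082 ∷ just 4090 ∷ just 4091 ∷ just 4095 ∷ [])
  ∷ (just 0 ∷ just 2 ∷ nothing ∷ just 3938 ∷ just 3954 ∷ just 4082 ∷ just 4090 ∷ just 4091 ∷ just 4095 ∷ [])
  ∷ (just 0 ∷ just 4 ∷ just 132 ∷ nothing ∷ just 3989 ∷ just 4021 ∷ just 4023 ∷ just 4031 ∷ just 4095 ∷ [])
  ∷ (just 0 ∷ just 4 ∷ nothing ∷ just 3884 ∷ just 3948 ∷ just 4076 ∷ just 4077 ∷ just 4093 ∷ just 4095 ∷ [])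
  ∷ (just 0 ∷ just 16 ∷ just 24 ∷ just 56 ∷ just 184 ∷ nothing ∷ just 4027 ∷ just 4031 ∷ just 4095 ∷ [])
  ∷ (just 0 ∷ just 16 ∷ just 24 ∷ just 56 ∷ nothing ∷ just 3961 ∷ just 3965 ∷ just 3967 ∷ just 4095 ∷ [])
  ∷ (just 0 ∷ just 16 ∷ just 24 ∷ just 152 ∷ nothing ∷ just 3995 ∷ just 4027 ∷ just 4031 ∷ just 4095 ∷ [])
  ∷ (just 0 ∷ just 16 ∷ just 80 ∷ just 84 ∷ just 116 ∷ nothing ∷ just 3959 ∷ just 3967 ∷ just 4095 ∷ [])
  ∷ (just 0 ∷ just 16 ∷ just 80 ∷ just 84 ∷ nothing ∷ just 4060 ∷ just 4062 ∷ just 4094 ∷ just 4095 ∷ [])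
  ∷ (just 0 ∷ just 16 ∷ nothing ∷ just 3892 ∷ just 3893 ∷ just 4021 ∷ just 4023 ∷ just 4031 ∷ just 4095 ∷ [])
  ∷ (just 0 ∷ just 32 ∷ just 160 ∷ just 162 ∷ nothing ∷ just 4082 ∷ just 4090 ∷ just 4091 ∷ just 4095 ∷ [])
  ∷ (just 0 ∷ just 32 ∷ just 160 ∷ just 176 ∷ nothing ∷ just 4021 ∷ just 4023 ∷ just 4031 ∷ just 4095 ∷ [])
  ∷ (just 0 ∷ just 32 ∷ just 160 ∷ nothing ∷ just 4012 ∷ just 4076 ∷ just 4077 ∷ just 4093 ∷ just 4095 ∷ [])
  ∷ (just 0 ∷ just 64 ∷ just 72 ∷ just 200 ∷ nothing ∷ just 4076 ∷ just 4077 ∷ just 4093 ∷ just 4095 ∷ [])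
  ∷ (just 0 ∷ just 64 ∷ just 72 ∷ nothing ∷ just 3948 ∷ just 4076 ∷ just 4077 ∷ just 4093 ∷ just 4095 ∷ [])
  ∷ (just 0 ∷ just 64 ∷ nothing ∷ just 3940 ∷ just 3948 ∷ just 4076 ∷ just 4077 ∷ just 4093 ∷ just 4095 ∷ [])
  ∷ (just 0 ∷ nothing ∷ just 3976 ∷ just 3977 ∷ just 3979 ∷ just 3995 ∷ just 4027 ∷ just 4031 ∷ just 4095 ∷ [])
  ∷ (just 0 ∷ just 2 ∷ just 6 ∷ just 134 ∷ just 135 ∷ nothing ∷ just 4055 ∷ just 4087 ∷ just 4095 ∷ [])
  ∷ (just 0 ∷ just 2 ∷ just 10 ∷ just 74 ∷ just 106 ∷ nothing ∷ just 3951 ∷ just 3967 ∷ just 4095 ∷ [])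
  ∷ (just 0 ∷ just 2 ∷ just 10 ∷ just 74 ∷ nothing ∷ just 3919 ∷ just 3951 ∷ just 3967 ∷ just 4095 ∷ [])
  ∷ (just 0 ∷ just 16 ∷ just 24 ∷ just 56 ∷ just 184 ∷ nothing ∷ just 4092 ∷ just 4093 ∷ just 4095 ∷ [])
  ∷ (just 0 ∷ just 16 ∷ just 24 ∷ nothing ∷ just 3870 ∷ just 3902 ∷ just 3903 ∷ just 3967 ∷ just 4095 ∷ [])
  ∷ (just 0 ∷ just 2 ∷ just 10 ∷ nothing ∷ just 3979 ∷ just 3995 ∷ just 4027 ∷ just 4031 ∷ just 4095 ∷ [])
  ∷ (just 0 ∷ just 16 ∷ just 80 ∷ nothing ∷ just 4050 ∷ just 4082 ∷ just 4090 ∷ just 4091 ∷ just 4095 ∷ [])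
  ∷ (just 0 ∷ just 1 ∷ just 3 ∷ just 19 ∷ nothing ∷ just 3995 ∷ just 4027 ∷ just 4031 ∷ just 4095 ∷ [])
  ∷ (just 0 ∷ just 1 ∷ just 33 ∷ just 97 ∷ nothing ∷ just 3961 ∷ just 3965 ∷ just 3967 ∷ just 4095 ∷ [])
  ∷ (just 0 ∷ just 2 ∷ just 6 ∷ just 38 ∷ nothing ∷ just 3943 ∷ just 3951 ∷ just 3967 ∷ just 4095 ∷ [])
  ∷ (just 0 ∷ just 2 ∷ just 6 ∷ nothing ∷ just 3911 ∷ just 3919 ∷ just 3951 ∷ just 3967 ∷ just 4095 ∷ [])
  ∷ (just 0 ∷ just 16 ∷ just 24 ∷ just 56 ∷ nothing ∷ just 3902 ∷ just 3903 ∷ just 3967 ∷ just 4095 ∷ [])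
  ∷ (just 0 ∷ just 16 ∷ just 24 ∷ just 152 ∷ nothing ∷ just 4060 ∷ just 4062 ∷ just 4094 ∷ just 4095 ∷ [])
  ∷ (just 0 ∷ just 16 ∷ just 80 ∷ just 84 ∷ just 116 ∷ nothing ∷ just 4092 ∷ just 4093 ∷ just 4095 ∷ [])
  ∷ (just 0 ∷ just 16 ∷ just 80 ∷ just 84 ∷ nothing ∷ just 3927 ∷ just 3959 ∷ just 3967 ∷ just 4095 ∷ [])
  ∷ (just 0 ∷ just 64 ∷ just 72 ∷ nothing ∷ just 3929 ∷ just 3961 ∷ just 3965 ∷ just 3967 ∷ just 4095 ∷ [])
  ∷ (just 0 ∷ just 1 ∷ just 5 ∷ just 13 ∷ just 29 ∷ nothing ∷ just 4029 ∷ just 4031 ∷ just 4095 ∷ [])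
  ∷ (just 0 ∷ just 1 ∷ just 5 ∷ just 13 ∷ just 45 ∷ nothing ∷ just 4077 ∷ just 4093 ∷ just 4095 ∷ [])
  ∷ (just 0 ∷ just 1 ∷ just 5 ∷ just 13 ∷ nothing ∷ just 4045 ∷ just 4077 ∷ just 4093 ∷ just 4095 ∷ [])
  ∷ (just 0 ∷ just 1 ∷ just 33 ∷ nothing ∷ just 3883 ∷ just 4011 ∷ just 4027 ∷ just 4031 ∷ just 4095 ∷ [])
  ∷ (just 0 ∷ just 1 ∷ just 65 ∷ just 193 ∷ just 209 ∷ just 217 ∷ nothing ∷ just 4093 ∷ just 4095 ∷ [])
  ∷ (just 0 ∷ just 2 ∷ just 6 ∷ just 134 ∷ just 135 ∷ just 143 ∷ nothing ∷ just 4031 ∷ just 4095 ∷ [])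
  ∷ (just 0 ∷ just 2 ∷ just 10 ∷ just 74 ∷ just 90 ∷ nothing ∷ just 4090 ∷ just 4091 ∷ just 4095 ∷ [])
  ∷ (just 0 ∷ just 2 ∷ nothing ∷ just 4034 ∷ just 4050 ∷ just 4082 ∷ just 4090 ∷ just 4091 ∷ just 4095 ∷ [])
  ∷ (just 0 ∷ just 4 ∷ just 132 ∷ nothing ∷ just 4068 ∷ just 4076 ∷ just 4077 ∷ just 4093 ∷ just 4095 ∷ [])
  ∷ (just 0 ∷ just 32 ∷ nothing ∷ just 3884 ∷ just 3948 ∷ just 4076 ∷ just 4077 ∷ just 4093 ∷ just 4095 ∷ [])
  ∷ (just 0 ∷ just 1 ∷ just 3 ∷ just 19 ∷ just 51 ∷ nothing ∷ just 3959 ∷ just 3967 ∷ just 4095 ∷ [])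
  ∷ (just 0 ∷ just 1 ∷ just 3 ∷ just 19 ∷ just 51 ∷ nothing ∷ just 4023 ∷ just 4031 ∷ just 4095 ∷ [])
  ∷ (just 0 ∷ just 1 ∷ just 3 ∷ nothing ∷ just 3979 ∷ just 3995 ∷ just 4027 ∷ just 4031 ∷ just 4095 ∷ [])
  ∷ (just 0 ∷ just 1 ∷ just 5 ∷ just 13 ∷ just 29 ∷ nothing ∷ just 3903 ∷ just 3967 ∷ just 4095 ∷ [])
  ∷ (just 0 ∷ just 1 ∷ just 17 ∷ nothing ∷ just 3893 ∷ just 4021 ∷ just 4023 ∷ just 4031 ∷ just 4095 ∷ [])
  ∷ (just 0 ∷ just 1 ∷ just 17 ∷ nothing ∷ just 3989 ∷ just 4021 ∷ just 4023 ∷ just 4031 ∷ just 4095 ∷ [])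
  ∷ (just 0 ∷ just 1 ∷ just 33 ∷ just 97 ∷ just 225 ∷ nothing ∷ just 4077 ∷ just 4093 ∷ just 4095 ∷ [])
  ∷ (just 0 ∷ just 1 ∷ just 33 ∷ just 161 ∷ nothing ∷ just 4021 ∷ just 4023 ∷ just 4031 ∷ just 4095 ∷ [])
  ∷ (just 0 ∷ just 1 ∷ just 65 ∷ just 193 ∷ nothing ∷ just 4045 ∷ just 4077 ∷ just 4093 ∷ just 4095 ∷ [])
  ∷ (just 0 ∷ just 2 ∷ just 6 ∷ just 38 ∷ just 166 ∷ just 230 ∷ nothing ∷ just 4087 ∷ just 4095 ∷ [])
  ∷ (just 0 ∷ just 2 ∷ just 10 ∷ just 74 ∷ just 106 ∷ nothing ∷ just 4075 ∷ just 4091 ∷ just 4095 ∷ [])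
  ∷ (just 0 ∷ just 2 ∷ just 10 ∷ just 74 ∷ nothing ∷ just 4043 ∷ just 4075 ∷ just 4091 ∷ just 4095 ∷ [])
  ∷ (just 0 ∷ just 2 ∷ just 10 ∷ nothing ∷ just 3883 ∷ just 4011 ∷ just 4027 ∷ just 4031 ∷ just 4095 ∷ [])
  ∷ (just 0 ∷ just 2 ∷ just 18 ∷ nothing ∷ just 4050 ∷ just 4082 ∷ just 4090 ∷ just 4091 ∷ just 4095 ∷ [])
  ∷ (just 0 ∷ just 4 ∷ just 132 ∷ nothing ∷ just 4012 ∷ just 4076 ∷ just 4077 ∷ just 4093 ∷ just 4095 ∷ [])
  ∷ (just 0 ∷ just 16 ∷ just 80 ∷ nothing ∷ just 3954 ∷ just 4082 ∷ just 4090 ∷ just 4091 ∷ just 4095 ∷ [])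
  ∷ (just 0 ∷ just 32 ∷ just 160 ∷ just 162 ∷ nothing ∷ just 4011 ∷ just 4027 ∷ just 4031 ∷ just 4095 ∷ [])
  ∷ (just 0 ∷ just 32 ∷ just 160 ∷ just 176 ∷ nothing ∷ just 4082 ∷ just 4090 ∷ just 4091 ∷ just 4095 ∷ [])
  ∷ (just 0 ∷ just 32 ∷ just 160 ∷ nothing ∷ just 4068 ∷ just 4076 ∷ just 4077 ∷ just 4093 ∷ just 4095 ∷ [])
  ∷ (just 0 ∷ just 64 ∷ nothing ∷ just 4034 ∷ just 4050 ∷ just 4082 ∷ just 4090 ∷ just 4091 ∷ just 4095 ∷ [])
  ∷ (just 0 ∷ just 16 ∷ nothing ∷ just 3984 ∷ just 3989 ∷ just 4021 ∷ just 4023 ∷ just 4031 ∷ just 4095 ∷ [])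
  ∷ []

gappedChains : List (Vec (Maybe (Subset 12)) 9)
gappedChains = map (Vec.map (Maybe.map (fromCode 12))) gappedChainCodes

open import Data.List.Membership.DecPropositional (_≟_ {12}) using (_∈?_)
open import Data.List.Relation.Unary.Unique.DecPropositional (_≟_ {12}) using (unique?)

levels-increase : All (λ A → All (λ B → A ⊂ B → levelOf levels A < levelOf levels B) family) family
levels-increase = from-yes (All.all? (λ A → All.all? (λ B →
  A ⊂? B →-dec levelOf levels A <? levelOf levels B) family) family)

gappedChains-in-family : All (IsGappedChainIn family) gappedChains
gappedChains-in-family = from-yes (All.all? (λ t →
  VecAll.all? (MaybeAll.dec (_∈? family)) t ×-dec linked? membersIncrease? t) gappedChains)

gappedChains-cover : ∀ (s : Subset 8) → Any (Linked (SlotAdmits (s ++ ∅) (s ++ full))) gappedChains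
gappedChains-cover = from-yes (allSubsets? λ (s : Subset 8) →
  Any.any? (linked? (slotAdmits? (s ++ ∅) (s ++ full))) gappedChains)

every-set-has-a-slot : ∀ S → Any (Linked (SlotAdmits S S)) gappedChains
every-set-has-a-slot S with s , s∅⊆S , S⊆sfull ← between-extensions 8 S =
  Any.map (Linked.map (SlotAdmits-shrink s∅⊆S S⊆sfull)) (gappedChains-cover s)

mainTheorem2 : ∃ (λ (F : Family 12) → Unique F × length F ≡ 108 × SaturatedKSperner 8 F)
mainTheorem2 =
  family , from-yes (unique? family) , refl ,
  levelled⇒KSperner levels (λ A∈ B∈ → All.lookup (All.lookup levels-increase A∈) B∈) ,
  gapped-chains⇒saturating family gappedChains gappedChains-in-family every-set-has-a-slot
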